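{- In the partizan restricted chocolate bar game described below, with the sets defined below: (i) if Left is to move from a position in $\mathcal{P}$, then every move of hers leads to a position in $\mathcal{R}\cup\mathcal{N}$; (ii) if Right is to move from a position in $\mathcal{P}$, then every move of his leads to a position in $\mathcal{L}\cup\mathcal{N}$.
   Context: A black-and-white chocolate bar $(x,y,s)$ with $x,y\in\mathbb{N}$, $s\in\{0,1\}$, is an $x\times y$ matrix (height $x$, width $y$) with entries in $\{0,1\}$ (1 = black, 0 = white) in a checkerboard pattern whose top-left entry is $s$: entry $(i,j)$ is $s$ if $i+j$ is even and $1-s$ otherwise. Partizan restricted chocolate bar game: players Left and Right alternate. On a move, the player cuts the bar along one horizontal or vertical grid line into two nonempty rectangular pieces and eats one of them; the other piece is the new position. Left may eat a piece only if it contains no more black (1) blocks than the other piece (if equal she may eat either); Right may eat a piece only if it contains no more white (0) blocks than the other (if equal, either). In addition, Left may eat the single white block $(1,1,0)$ and Right may eat the single black block $(1,1,1)$, leaving the empty bar, denoted $(0,0)$. A player who cannot move loses. Sets: $\mathcal{P}_a=\{(2^n(2p+5)-1,2^m(2p+5)-1,s): n,m,p\in\mathbb{Z}_{\ge0}, s\in\{0,1\}\}$, $\mathcal{P}_b=\{(2^n3-1,2^m4-1,s): n,m\in\mathbb{Z}_{\ge0}, s\in\{0,1\}\}$, $\mathcal{P}_c=\{(2^n4-1,2^m3-1,s): n,m\in\mathbb{Z}_{\ge0}, s\in\{0,1\}\}$, $\mathcal{P}=\mathcal{P}_a\cup\mathcal{P}_b\cup\mathcal{P}_c\cup\{(1,2,s),(2,1,s):s\in\{0,1\}\}\cup\{(0,0)\}$.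 $\mathcal{L}=\{(2n+5,1,0),(1,2n+5,0):n\in\mathbb{Z}_{\ge0}\}\cup\{(1,1,0)\}$. $\mathcal{R}=\{(2n+5,1,1),(1,2n+5,1):n\in\mathbb{Z}_{\ge0}\}\cup\{(1,1,1)\}$. $\mathcal{N}=\{(x,y,s):x,y\in\mathbb{N}, s\in\{0,1\}\}\setminus(\mathcal{P}\cup\mathcal{L}\cup\mathcal{R})$. -}

module Defs where

open import Data.Nat using (ℕ; zero; suc; _+_; _*_; _∸_; _^_; _≤_; _<_)
open import Data.Bool using (Bool; true; false; not; if_then_else_)
open import Data.List using (List; upTo; map)
open import Data.Nat.ListAction using (sum)
open import Data.Empty using (⊥)
open import Data.Product using (∃; ∃-syntax; _×_)
open import Data.Sum using (_⊎_)
open import Relation.Nullary using (¬_)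
open import Relation.Binary.PropositionalEquality using (_≡_)

-- Colours: true = 1 = black, false = 0 = white.

flip : ℕ → Bool → Bool
flip zero    s = s
flip (suc k) s = not (flip k s)

-- Entry (i,j) (0-indexed) of the checkerboard with top-left entry s:
-- s if i+j is even, 1-s otherwise (same parity as the paper's 1-indexed convention).
entry : Bool → ℕ → ℕ → Bool
entry s i j = flip (i + j) s

count : Bool → ℕ → ℕ → Bool → ℕ
count c x y s =
  sum (map (λ i → sum (map (λ j → if isC (entry s i j) then 1 else 0) (upTo y))) (upTo x))
  where
    isC : Bool → Bool
    isC b = if c then b else not b

blacks : ℕ → ℕ → Bool → ℕ
blacks = count true

whites : ℕ → ℕ → Bool → ℕ
whites = count false

data Pos : Set where
  empty : Pos
  bar   : ℕ → ℕ → Bool → Pos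

-- Pieces after cutting the x × y bar (top-left s)
-- horizontally after row k (top piece has k rows), or vertically after column k.
-- The second piece's top-left entry is the original entry at (k,0) resp. (0,k).
topP : ℕ → ℕ → Bool → ℕ → Pos
topP x y s k = bar k y s

bottomP : ℕ → ℕ → Bool → ℕ → Pos
bottomP x y s k = bar (x ∸ k) y (flip k s)

leftP : ℕ → ℕ → Bool → ℕ → Pos
leftP x y s k = bar x k s

rightP : ℕ → ℕ → Bool → ℕ → Pos
rightP x y s k = bar x (y ∸ k) (flip k s)

data LeftMove : Pos → Pos → Set where
  eatWhite : LeftMove (bar 1 1 false) empty
  hKeepBottom : ∀ {x y s k} → 1 ≤ k → k < x →
    blacks k y s ≤ blacks (x ∸ k) y (flip k s) → LeftMove (bar x y s) (bottomP x y s k)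
  hKeepTop : ∀ {x y s k} → 1 ≤ k → k < x →
    blacks (x ∸ k) y (flip k s) ≤ blacks k y s → LeftMove (bar x y s) (topP x y s k)
  vKeepRight : ∀ {x y s k} → 1 ≤ k → k < y →
    blacks x k s ≤ blacks x (y ∸ k) (flip k s) → LeftMove (bar x y s) (rightP x y s k)
  vKeepLeft : ∀ {x y s k} → 1 ≤ k → k < y →
    blacks x (y ∸ k) (flip k s) ≤ blacks x k s → LeftMove (bar x y s) (leftP x y s k)

data RightMove : Pos → Pos → Set where
  eatBlack : RightMove (bar 1 1 true) empty
  hKeepBottom : ∀ {x y s k} → 1 ≤ k → k < x →
    whites k y s ≤ whites (x ∸ k) y (flip k s) → RightMove (bar x y s) (bottomP x y s k)
  hKeepTop : ∀ {x y s k} → 1 ≤ k → k < x →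
    whites (x ∸ k) y (flip k s) ≤ whites k y s → RightMove (bar x y s) (topP x y s k)
  vKeepRight : ∀ {x y s k} → 1 ≤ k → k < y →
    whites x k s ≤ whites x (y ∸ k) (flip k s) → RightMove (bar x y s) (rightP x y s k)
  vKeepLeft : ∀ {x y s k} → 1 ≤ k → k < y →
    whites x (y ∸ k) (flip k s) ≤ whites x k s → RightMove (bar x y s) (leftP x y s k)

data InP : Pos → Set where
  Pa : ∀ {s} n m p →
    InP (bar (2 ^ n * (2 * p + 5) ∸ 1) (2 ^ m * (2 * p + 5) ∸ 1) s)
  Pb : ∀ {s} n m → InP (bar (2 ^ n * 3 ∸ 1) (2 ^ m * 4 ∸ 1) s)
  Pc : ∀ {s} n m → InP (bar (2 ^ n * 4 ∸ 1) (2 ^ m * 3 ∸ 1) s)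
  P12 : ∀ {s} → InP (bar 1 2 s)
  P21 : ∀ {s} → InP (bar 2 1 s)
  P00 : InP empty

data InL : Pos → Set where
  Lcol : ∀ n → InL (bar (2 * n + 5) 1 false)
  Lrow : ∀ n → InL (bar 1 (2 * n + 5) false)
  L11  : InL (bar 1 1 false)

data InR : Pos → Set where
  Rcol : ∀ n → InR (bar (2 * n + 5) 1 true)
  Rrow : ∀ n → InR (bar 1 (2 * n + 5) true)
  R11  : InR (bar 1 1 true)

InN : Pos → Set
InN empty       = ⊥
InN (bar x y s) = (1 ≤ x) × (1 ≤ y) × ¬ InP (bar x y s) × ¬ InL (bar x y s) × ¬ InR (bar x y s)

module Submission where

-- A bar with top-left colour s has ⌊xy/2⌋ or ⌈xy/2⌉ blocks of colour c, the latter exactly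
-- when xy is odd and s = c.  So once the cut runs across at least two blocks, a player may
-- only eat the smaller part: cutting an x-row bar keeps h rows with h < x ≤ 2h.  For every
-- P-position, x + 1 and y + 1 have odd parts that are equal and at least 5, or are 1 and 3.
-- Two numbers with the same odd part never lie strictly between n and 2n, so the kept piece
-- is not in P; it can only be a strip, in L or R, when a single row is kept from a bar of
-- height 2.  That row has odd length and must hold the majority of the colour restricting the
-- mover, so it starts with that colour: black for Left, giving a position in R, white for
-- Right, giving one in L, unless it is the 1 × 3 bar, which is in N.

open import Defs
open import Data.Bool using (Bool; true; false; not; if_then_else_)
open import Data.Bool.Properties using (not-involutive)
open import Data.Empty using (⊥; ⊥-elim)
open import Data.List using (upTo; applyUpTo; map)
open import Data.List.Properties using (map-cong; map-upTo)
open import Data.Nat using (ℕ; zero; suc; _+_; _*_; _∸_; _^_; _≤_; _<_; z≤n; s≤s; ⌊_/2⌋)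
open import Data.Nat.ListAction using (sum)
open import Data.Nat.Properties
open import Data.Nat.Tactic.RingSolver using (solve-∀)
open import Data.Product using (∃-syntax; _×_; _,_)
open import Data.Sum using (_⊎_; inj₁; inj₂)
open import Function using (_∘_)
open import Relation.Nullary using (¬_; yes; no)
open import Relation.Binary.PropositionalEquality

-- Counting blocks

δ : Bool → Bool → ℕ
δ c b = if (if c then b else not b) then 1 else 0

δ-complement : ∀ c b → δ c b + δ c (not b) ≡ 1
δ-complement true  true  = refl
δ-complement true  false = refl
δ-complement false true  = refl
δ-complement false false = refl

δ≤1 : ∀ c b → δ c b ≤ 1
δ≤1 c b = subst (δ c b ≤_) (δ-complement c b) (m≤m+n (δ c b) (δ c (not b)))

⌊1+d/2⌋≡d : ∀ {d} → d ≤ 1 → ⌊ 1 + d /2⌋ ≡ d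
⌊1+d/2⌋≡d z≤n       = refl
⌊1+d/2⌋≡d (s≤s z≤n) = refl

⌊m+m+n/2⌋≡m+⌊n/2⌋ : ∀ m n → ⌊ m + m + n /2⌋ ≡ m + ⌊ n /2⌋
⌊m+m+n/2⌋≡m+⌊n/2⌋ zero    n = refl
⌊m+m+n/2⌋≡m+⌊n/2⌋ (suc m) n rewrite +-suc m m = cong suc (⌊m+m+n/2⌋≡m+⌊n/2⌋ m n)

⌊w+d/2⌋+⌊w+d′/2⌋≡w : ∀ w {d d′} → d + d′ ≡ 1 → ⌊ w + d /2⌋ + ⌊ w + d′ /2⌋ ≡ w
⌊w+d/2⌋+⌊w+d′/2⌋≡w w {zero} refl
  rewrite +-identityʳ w | +-comm w 1 = ⌊n/2⌋+⌈n/2⌉≡n w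
⌊w+d/2⌋+⌊w+d′/2⌋≡w w {suc zero} refl
  rewrite +-identityʳ w | +-comm w 1 = trans (+-comm _ ⌊ w /2⌋) (⌊n/2⌋+⌈n/2⌉≡n w)

Alternating : (ℕ → ℕ) → Set
Alternating d = ∀ i → d i + d (suc i) ≡ 1

alternating-≤1 : ∀ d → Alternating d → ∀ i → d i ≤ 1
alternating-≤1 d alt i = subst (d i ≤_) (alt i) (m≤m+n (d i) (d (suc i)))

sum-⌊w+alternating/2⌋ : ∀ w d → Alternating d → ∀ n →
  sum (applyUpTo (λ i → ⌊ w + d i /2⌋) n) ≡ ⌊ n * w + d 0 /2⌋
sum-⌊w+alternating/2⌋ w d alt zero =
  sym (n≤0⇒n≡0 (⌊n/2⌋-mono (alternating-≤1 d alt 0)))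
sum-⌊w+alternating/2⌋ w d alt (suc zero) rewrite +-identityʳ w = +-identityʳ _
sum-⌊w+alternating/2⌋ w d alt (suc (suc n)) = begin
  ⌊ w + d 0 /2⌋ + (⌊ w + d 1 /2⌋ + rest)
    ≡⟨ +-assoc ⌊ w + d 0 /2⌋ ⌊ w + d 1 /2⌋ rest ⟨
  ⌊ w + d 0 /2⌋ + ⌊ w + d 1 /2⌋ + rest
    ≡⟨ cong₂ _+_ (⌊w+d/2⌋+⌊w+d′/2⌋≡w w (alt 0)) rest-closed ⟩
  w + ⌊ n * w + d 0 /2⌋
    ≡⟨ ⌊m+m+n/2⌋≡m+⌊n/2⌋ w _ ⟨
  ⌊ w + w + (n * w + d 0) /2⌋
    ≡⟨ cong ⌊_/2⌋ regroup ⟩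
  ⌊ suc (suc n) * w + d 0 /2⌋
    ∎
  where
    open ≡-Reasoning
    rest : ℕ
    rest = sum (applyUpTo (λ i → ⌊ w + d (suc (suc i)) /2⌋) n)
    d2≡d0 : d 2 ≡ d 0
    d2≡d0 = +-cancelˡ-≡ (d 1) _ _ (trans (alt 1) (trans (sym (alt 0)) (+-comm (d 0) (d 1))))
    regroup : w + w + (n * w + d 0) ≡ w + (w + n * w) + d 0
    regroup = trans (sym (+-assoc (w + w) (n * w) (d 0))) (cong (_+ d 0) (+-assoc w w (n * w)))
    rest-closed : rest ≡ ⌊ n * w + d 0 /2⌋
    rest-closed = trans (sum-⌊w+alternating/2⌋ w (d ∘ suc ∘ suc) (alt ∘ suc ∘ suc) n)
                        (cong (λ v → ⌊ n * w + v /2⌋) d2≡d0)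

count-closed : ∀ c x y s → count c x y s ≡ ⌊ x * y + δ c s /2⌋
count-closed c x y s = begin
  sum (map row (upTo x))
    ≡⟨ cong sum (map-cong row-closed (upTo x)) ⟩
  sum (map (λ i → ⌊ y + lead i /2⌋) (upTo x))
    ≡⟨ cong sum (map-upTo _ x) ⟩
  sum (applyUpTo (λ i → ⌊ y + lead i /2⌋) x)
    ≡⟨ sum-⌊w+alternating/2⌋ y lead (λ i → δ-complement c (flip i s)) x ⟩
  ⌊ x * y + δ c s /2⌋
    ∎
  where
    open ≡-Reasoning
    lead : ℕ → ℕ
    lead i = δ c (flip i s)
    cell : ℕ → ℕ → ℕ
    cell i j = δ c (flip (i + j) s)
    row : ℕ → ℕ
    row i = sum (map (cell i) (upTo y))
    cells-alternate : ∀ i → Alternating (cell i)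
    cells-alternate i j rewrite +-suc i j = δ-complement c (flip (i + j) s)
    cell≡⌊1+cell/2⌋ : ∀ i j → cell i j ≡ ⌊ 1 + cell i j /2⌋
    cell≡⌊1+cell/2⌋ i j = sym (⌊1+d/2⌋≡d (alternating-≤1 (cell i) (cells-alternate i) j))
    row-closed : ∀ i → row i ≡ ⌊ y + lead i /2⌋
    row-closed i = begin
      sum (map (cell i) (upTo y))
        ≡⟨ cong sum (map-cong (cell≡⌊1+cell/2⌋ i) (upTo y)) ⟩
      sum (map (λ j → ⌊ 1 + cell i j /2⌋) (upTo y))
        ≡⟨ cong sum (map-upTo _ y) ⟩
      sum (applyUpTo (λ j → ⌊ 1 + cell i j /2⌋) y)
        ≡⟨ sum-⌊w+alternating/2⌋ 1 (cell i) (cells-alternate i) y ⟩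
      ⌊ y * 1 + cell i 0 /2⌋
        ≡⟨ cong₂ (λ a b → ⌊ a + lead b /2⌋) (*-identityʳ y) (+-identityʳ i) ⟩
      ⌊ y + lead i /2⌋
        ∎

count-transpose : ∀ c x y s → count c x y s ≡ count c y x s
count-transpose c x y s = begin
  count c x y s        ≡⟨ count-closed c x y s ⟩
  ⌊ x * y + δ c s /2⌋  ≡⟨ cong (λ n → ⌊ n + δ c s /2⌋) (*-comm x y) ⟩
  ⌊ y * x + δ c s /2⌋  ≡⟨ count-closed c y x s ⟨
  count c y x s        ∎
  where open ≡-Reasoning

⌊h*w+1/2⌋<⌊[1+h]*w/2⌋ : ∀ h {w} → 2 ≤ w → ⌊ h * w + 1 /2⌋ < ⌊ suc h * w /2⌋
⌊h*w+1/2⌋<⌊[1+h]*w/2⌋ h {suc zero} (s≤s ())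
⌊h*w+1/2⌋<⌊[1+h]*w/2⌋ h {suc (suc zero)} _ = s≤s (≤-reflexive (begin
  ⌊ h * 2 + 1 /2⌋  ≡⟨ cong (λ n → ⌊ n + 1 /2⌋) h*2≡h+h ⟩
  ⌊ h + h + 1 /2⌋  ≡⟨ ⌊m+m+n/2⌋≡m+⌊n/2⌋ h 1 ⟩
  h + 0            ≡⟨ ⌊m+m+n/2⌋≡m+⌊n/2⌋ h 0 ⟨
  ⌊ h + h + 0 /2⌋  ≡⟨ cong ⌊_/2⌋ (trans (+-identityʳ (h + h)) (sym h*2≡h+h)) ⟩
  ⌊ h * 2 /2⌋      ∎))
  where
    open ≡-Reasoning
    h*2≡h+h : h * 2 ≡ h + h
    h*2≡h+h = trans (*-suc h 1) (cong (h +_) (*-identityʳ h))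
⌊h*w+1/2⌋<⌊[1+h]*w/2⌋ h {suc (suc (suc w))} _ =
  s≤s (⌊n/2⌋-mono (subst (_≤ suc w + h * suc (suc (suc w))) (+-comm 1 _) (s≤s (m≤n+m _ w))))

more-rows⇒more-of-each-colour : ∀ c {h e y} t u → 2 ≤ y → h < e → count c h y t < count c e y u
more-rows⇒more-of-each-colour c {h} {e} {y} t u 2≤y h<e = begin-strict
  count c h y t        ≡⟨ count-closed c h y t ⟩
  ⌊ h * y + δ c t /2⌋  ≤⟨ ⌊n/2⌋-mono (+-monoʳ-≤ (h * y) (δ≤1 c t)) ⟩
  ⌊ h * y + 1 /2⌋      <⟨ ⌊h*w+1/2⌋<⌊[1+h]*w/2⌋ h 2≤y ⟩
  ⌊ suc h * y /2⌋      ≤⟨ ⌊n/2⌋-mono (≤-trans (*-monoˡ-≤ y h<e) (m≤m+n (e * y) (δ c u))) ⟩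
  ⌊ e * y + δ c u /2⌋  ≡⟨ count-closed c e y u ⟨
  count c e y u        ∎
  where open ≤-Reasoning

-- Parity and odd parts

data Odd : ℕ → Set where
  1-odd  : Odd 1
  2+-odd : ∀ {n} → Odd n → Odd (2 + n)

¬Odd-2* : ∀ m → ¬ Odd (2 * m)
¬Odd-2* zero    ()
¬Odd-2* (suc m) o with subst Odd (*-suc 2 m) o
... | 2+-odd o′ = ¬Odd-2* m o′

parity : ∀ n → Odd n ⊎ Odd (suc n)
parity zero    = inj₂ 1-odd
parity (suc n) with parity n
... | inj₁ o = inj₂ (2+-odd o)
... | inj₂ o = inj₁ o

suc≡2*⇒Odd : ∀ {n} m → suc n ≡ 2 * m → Odd n
suc≡2*⇒Odd {n} m eq with parity n
... | inj₁ o = o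
... | inj₂ o = ⊥-elim (¬Odd-2* m (subst Odd eq o))

Odd-2*+ : ∀ p {n} → Odd n → Odd (2 * p + n)
Odd-2*+ zero        o = o
Odd-2*+ (suc p) {n} o = subst Odd (sym (cong (_+ n) (*-suc 2 p))) (2+-odd (Odd-2*+ p o))

Odd⇒1+2* : ∀ {n} → Odd n → ∃[ k ] n ≡ 1 + 2 * k
Odd⇒1+2* 1-odd = 0 , refl
Odd⇒1+2* (2+-odd o) with Odd⇒1+2* o
... | k , refl = suc k , cong suc (sym (*-suc 2 k))

⌊odd+d/2⌋≡⌊odd/2⌋+d : ∀ {n d} → Odd n → d ≤ 1 → ⌊ n + d /2⌋ ≡ ⌊ n /2⌋ + d
⌊odd+d/2⌋≡⌊odd/2⌋+d 1-odd      d≤1 = ⌊1+d/2⌋≡d d≤1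
⌊odd+d/2⌋≡⌊odd/2⌋+d (2+-odd o) d≤1 = cong suc (⌊odd+d/2⌋≡⌊odd/2⌋+d o d≤1)

δ-majority : ∀ c t → δ c (not t) ≤ δ c t → t ≡ c
δ-majority true  true  _  = refl
δ-majority true  false ()
δ-majority false true  ()
δ-majority false false _  = refl

odd-area⇒top-left-majority : ∀ c {x y} t → Odd (x * y) →
  count c x y (not t) ≤ count c x y t → t ≡ c
odd-area⇒top-left-majority c {x} {y} t odd le = δ-majority c t (+-cancelˡ-≤ ⌊ x * y /2⌋ _ _ (begin
  ⌊ x * y /2⌋ + δ c (not t)  ≡⟨ ⌊odd+d/2⌋≡⌊odd/2⌋+d odd (δ≤1 c (not t)) ⟨
  ⌊ x * y + δ c (not t) /2⌋  ≡⟨ count-closed c x y (not t) ⟨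
  count c x y (not t)        ≤⟨ le ⟩
  count c x y t              ≡⟨ count-closed c x y t ⟩
  ⌊ x * y + δ c t /2⌋        ≡⟨ ⌊odd+d/2⌋≡⌊odd/2⌋+d odd (δ≤1 c t) ⟩
  ⌊ x * y /2⌋ + δ c t        ∎))
  where open ≤-Reasoning

2^*z-cancel-odd : ∀ a b {z w} → Odd z → Odd w → 2 ^ a * z ≡ 2 ^ b * w → z ≡ w
2^*z-cancel-odd zero zero {z} {w} _ _ eq = trans (sym (+-identityʳ z)) (trans eq (+-identityʳ w))
2^*z-cancel-odd zero (suc b) {z} {w} oz _ eq =
  ⊥-elim (¬Odd-2* (2 ^ b * w) (subst Odd z≡2*[2^b*w] oz))
  where
    z≡2*[2^b*w] : z ≡ 2 * (2 ^ b * w)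
    z≡2*[2^b*w] = trans (sym (+-identityʳ z)) (trans eq (*-assoc 2 (2 ^ b) w))
2^*z-cancel-odd (suc a) zero oz ow eq = sym (2^*z-cancel-odd zero (suc a) ow oz (sym eq))
2^*z-cancel-odd (suc a) (suc b) {z} {w} oz ow eq = 2^*z-cancel-odd a b oz ow
  (*-cancelˡ-≡ _ _ 2 (trans (sym (*-assoc 2 (2 ^ a) z)) (trans eq (*-assoc 2 (2 ^ b) w))))

2^[1+a]*z≡2^a*z+2^a*z : ∀ a z → 2 ^ suc a * z ≡ 2 ^ a * z + 2 ^ a * z
2^[1+a]*z≡2^a*z+2^a*z a z = trans (*-assoc 2 (2 ^ a) z) (cong (2 ^ a * z +_) (+-identityʳ (2 ^ a * z)))

no-2^-multiple-strictly-between-doubles : ∀ z a b →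
  2 ^ a * z < 2 ^ b * z → 2 ^ b * z < 2 ^ suc a * z → ⊥
no-2^-multiple-strictly-between-doubles z a b lower upper with b ≤? a
... | yes b≤a = <⇒≱ lower (*-monoˡ-≤ z (^-monoʳ-≤ 2 b≤a))
... | no  b≰a = <⇒≱ upper (*-monoˡ-≤ z (^-monoʳ-≤ 2 (≰⇒> b≰a)))

infix 4 _HasOddPart_

_HasOddPart_ : ℕ → ℕ → Set
n HasOddPart z = Odd z × ∃[ a ] n ≡ 2 ^ a * z

HasOddPart-unique : ∀ {n z w} → n HasOddPart z → n HasOddPart w → z ≡ w
HasOddPart-unique (oz , a , refl) (ow , b , eq) = 2^*z-cancel-odd a b oz ow eq

2^-HasOddPart-1 : ∀ a → 2 ^ a HasOddPart 1
2^-HasOddPart-1 a = 1-odd , a , sym (*-identityʳ (2 ^ a))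

suc[n∸1]-HasOddPart : ∀ a {n z} → n ≡ 2 ^ a * z → Odd z → suc (n ∸ 1) HasOddPart z
suc[n∸1]-HasOddPart a {z = z} refl oz =
  oz , a , suc[m∸1]≡m (≤-trans (Odd⇒1≤ oz) (m≤n*m z (2 ^ a) {{m^n≢0 2 a}}))
  where
    suc[m∸1]≡m : ∀ {m} → 1 ≤ m → suc (m ∸ 1) ≡ m
    suc[m∸1]≡m (s≤s _) = refl
    Odd⇒1≤ : ∀ {m} → Odd m → 1 ≤ m
    Odd⇒1≤ 1-odd      = s≤s z≤n
    Odd⇒1≤ (2+-odd _) = s≤s z≤n

-- The shape of P-positions

partner : ℕ → ℕ
partner 1 = 3
partner 3 = 1
partner n = n

partner-involutive : ∀ n → partner (partner n) ≡ n
partner-involutive 0 = refl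
partner-involutive 1 = refl
partner-involutive 2 = refl
partner-involutive 3 = refl
partner-involutive (suc (suc (suc (suc n)))) = refl

-- Every P-position (x, y) has PShape (x + 1) (y + 1); the converse fails, e.g. for (5, 1).
PShape : ℕ → ℕ → Set
PShape X Y = ∃[ w ] (Y HasOddPart w × X HasOddPart partner w)

2^*4≡2^[2+]*1 : ∀ m → 2 ^ m * 4 ≡ 2 ^ (2 + m) * 1
2^*4≡2^[2+]*1 m = q*4≡2*[2*q]*1 (2 ^ m)
  where
    q*4≡2*[2*q]*1 : ∀ q → q * 4 ≡ 2 * (2 * q) * 1
    q*4≡2*[2*q]*1 = solve-∀

InP⇒PShape : ∀ {x y s} → InP (bar x y s) → PShape (suc x) (suc y)
InP⇒PShape (Pa n m p) =
  2 * p + 5 , suc[n∸1]-HasOddPart m refl odd ,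
  subst (suc (2 ^ n * (2 * p + 5) ∸ 1) HasOddPart_) (sym fixed) (suc[n∸1]-HasOddPart n refl odd)
  where
    odd : Odd (2 * p + 5)
    odd = Odd-2*+ p (2+-odd (2+-odd 1-odd))
    fixed : partner (2 * p + 5) ≡ 2 * p + 5
    fixed = trans (cong partner (+-comm (2 * p) 5)) (+-comm 5 (2 * p))
InP⇒PShape (Pb n m) =
  1 , suc[n∸1]-HasOddPart (2 + m) (2^*4≡2^[2+]*1 m) 1-odd , suc[n∸1]-HasOddPart n refl (2+-odd 1-odd)
InP⇒PShape (Pc n m) =
  3 , suc[n∸1]-HasOddPart m refl (2+-odd 1-odd) , suc[n∸1]-HasOddPart (2 + n) (2^*4≡2^[2+]*1 n) 1-odd
InP⇒PShape P12 = 3 , (2+-odd 1-odd , 0 , refl) , 2^-HasOddPart-1 1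
InP⇒PShape P21 = 1 , 2^-HasOddPart-1 1 , (2+-odd 1-odd , 0 , refl)

¬PShape-2^-2^ : ∀ a b → ¬ PShape (2 ^ a) (2 ^ b)
¬PShape-2^-2^ a b (w , Yw , Xpw) with HasOddPart-unique Yw (2^-HasOddPart-1 b)
... | refl with HasOddPart-unique Xpw (2^-HasOddPart-1 a)
... | ()

single-block-∉P : ∀ {s} → ¬ InP (bar 1 1 s)
single-block-∉P P = ¬PShape-2^-2^ 1 1 (InP⇒PShape P)

suc≡2^⇒Odd : ∀ b {y} → 1 ≤ y → suc y ≡ 2 ^ b * 1 → Odd y
suc≡2^⇒Odd zero    (s≤s _) ()
suc≡2^⇒Odd (suc b) _       eq = suc≡2*⇒Odd (2 ^ b * 1) (trans eq (*-assoc 2 (2 ^ b) 1))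

PShape-3⇒Odd : ∀ {y} → PShape 3 (suc y) → 1 ≤ y → Odd y
PShape-3⇒Odd (w , (_ , b , eY) , Xpw) 1≤y = suc≡2^⇒Odd b 1≤y (trans eY (cong (2 ^ b *_) w≡1))
  where
    w≡1 : w ≡ 1
    w≡1 = trans (sym (partner-involutive w))
                (cong partner (HasOddPart-unique Xpw (2+-odd 1-odd , 0 , refl)))

PShape-gap : ∀ {X H Y} → PShape X Y → PShape H Y → H < X → X < H + H → ⊥
PShape-gap (w , Yw , (_ , a , refl)) (w′ , Yw′ , (_ , a′ , eH)) H<X X<2H
  with HasOddPart-unique Yw Yw′
... | refl = no-2^-multiple-strictly-between-doubles (partner w) a′ a
  (subst (_< 2 ^ a * partner w) eH H<X)
  (subst (2 ^ a * partner w <_)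
         (trans (cong₂ _+_ eH eH) (sym (2^[1+a]*z≡2^a*z+2^a*z a′ (partner w)))) X<2H)

2≤2^m*k∸1 : ∀ m {k} → 3 ≤ k → 2 ≤ 2 ^ m * k ∸ 1
2≤2^m*k∸1 m {k} 3≤k = ∸-monoˡ-≤ 1 (≤-trans 3≤k (m≤n*m k (2 ^ m) {{m^n≢0 2 m}}))

InP-rows : ∀ {x y s} → InP (bar x y s) → 2 ≤ y ⊎ (x ≡ 2 × y ≡ 1)
InP-rows (Pa n m p) = inj₁ (2≤2^m*k∸1 m (≤-trans (s≤s (s≤s (s≤s z≤n))) (m≤n+m 5 (2 * p))))
InP-rows (Pb n m)   = inj₁ (2≤2^m*k∸1 m (s≤s (s≤s (s≤s z≤n))))
InP-rows (Pc n m)   = inj₁ (2≤2^m*k∸1 m ≤-refl)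
InP-rows P12        = inj₁ ≤-refl
InP-rows P21        = inj₂ (refl , refl)

-- Transposition and the classes L, R and N

transpose : Pos → Pos
transpose empty       = empty
transpose (bar x y s) = bar y x s

InP-transpose : ∀ {p} → InP p → InP (transpose p)
InP-transpose (Pa n m p) = Pa m n p
InP-transpose (Pb n m)   = Pc m n
InP-transpose (Pc n m)   = Pb m n
InP-transpose P12        = P21
InP-transpose P21        = P12
InP-transpose P00        = P00

InL-transpose : ∀ {p} → InL p → InL (transpose p)
InL-transpose (Lcol n) = Lrow n
InL-transpose (Lrow n) = Lcol n
InL-transpose L11      = L11

InR-transpose : ∀ {p} → InR p → InR (transpose p)
InR-transpose (Rcol n) = Rrow n
InR-transpose (Rrow n) = Rcol n
InR-transpose R11      = R11

InN-transpose : ∀ {p} → InN p → InN (transpose p)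
InN-transpose {bar x y s} (1≤x , 1≤y , ¬P , ¬L , ¬R) =
  1≤y , 1≤x , ¬P ∘ InP-transpose , ¬L ∘ InL-transpose , ¬R ∘ InR-transpose

Strips : Bool → Pos → Set
Strips true  = InR
Strips false = InL

Strips-transpose : ∀ c {p} → Strips c p → Strips c (transpose p)
Strips-transpose true  = InR-transpose
Strips-transpose false = InL-transpose

NarrowStrip : ℕ → ℕ → Set
NarrowStrip x y = (x ≡ 1 × y ≢ 3) ⊎ (y ≡ 1 × x ≢ 3)

¬NarrowStrip-fat : ∀ {x y} → 2 ≤ x → 2 ≤ y → ¬ NarrowStrip x y
¬NarrowStrip-fat (s≤s (s≤s _)) _ (inj₁ (() , _))
¬NarrowStrip-fat _ (s≤s (s≤s _)) (inj₂ (() , _))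

2*n+5≢3 : ∀ n → 2 * n + 5 ≢ 3
2*n+5≢3 n eq = <⇒≱ (s≤s (s≤s (s≤s (s≤s z≤n)))) (subst (5 ≤_) eq (m≤n+m 5 (2 * n)))

InL⇒NarrowStrip : ∀ {x y s} → InL (bar x y s) → NarrowStrip x y
InL⇒NarrowStrip (Lcol n) = inj₂ (refl , 2*n+5≢3 n)
InL⇒NarrowStrip (Lrow n) = inj₁ (refl , 2*n+5≢3 n)
InL⇒NarrowStrip L11      = inj₁ (refl , λ ())

InR⇒NarrowStrip : ∀ {x y s} → InR (bar x y s) → NarrowStrip x y
InR⇒NarrowStrip (Rcol n) = inj₂ (refl , 2*n+5≢3 n)
InR⇒NarrowStrip (Rrow n) = inj₁ (refl , 2*n+5≢3 n)
InR⇒NarrowStrip R11      = inj₁ (refl , λ ())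

InN-intro : ∀ {x y t} → 1 ≤ x → 1 ≤ y → ¬ PShape (suc x) (suc y) → ¬ NarrowStrip x y →
  InN (bar x y t)
InN-intro 1≤x 1≤y ¬shape ¬narrow =
  1≤x , 1≤y , ¬shape ∘ InP⇒PShape , ¬narrow ∘ InL⇒NarrowStrip , ¬narrow ∘ InR⇒NarrowStrip

odd-strip-outcome : ∀ c {y} → Odd y → Strips c (bar 1 y c) ⊎ InN (bar 1 y c)
odd-strip-outcome true  1-odd = inj₁ R11
odd-strip-outcome false 1-odd = inj₁ L11
odd-strip-outcome c (2+-odd 1-odd) =
  inj₂ (InN-intro (s≤s z≤n) (s≤s z≤n) (¬PShape-2^-2^ 1 2) ¬narrow)
  where
    ¬narrow : ¬ NarrowStrip 1 3
    ¬narrow (inj₁ (_ , 3≢3)) = 3≢3 refl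
    ¬narrow (inj₂ (() , _))
odd-strip-outcome c (2+-odd (2+-odd o)) with Odd⇒1+2* o
... | k , refl = inj₁ (subst (λ n → Strips c (bar 1 n c)) (+-comm (2 * k) 5) (long c))
  where
    long : ∀ c → Strips c (bar 1 (2 * k + 5) c)
    long true  = Rrow k
    long false = Lrow k

-- Cuts

-- An x × y bar cut across its rows into an eaten e × y piece with top-left colour u and a kept
-- h × y piece with top-left colour t.  Whichever piece lies on top, the lower one starts with
-- the colour of the upper one flipped by its height.
record RowCut (c : Bool) (x y e h : ℕ) (u t : Bool) : Set where
  field
    eaten-nonempty : 1 ≤ e
    kept-nonempty  : 1 ≤ h
    split          : e + h ≡ x
    adjacent       : u ≡ flip h t ⊎ t ≡ flip e u
    allowed        : count c e y u ≤ count c h y t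

open RowCut

eaten≤kept : ∀ {c x y e h u t} → 2 ≤ y → RowCut c x y e h u t → e ≤ h
eaten≤kept {c} {u = u} {t} 2≤y r =
  ≮⇒≥ (λ h<e → <⇒≱ (more-rows⇒more-of-each-colour c t u 2≤y h<e) (allowed r))

fat-piece-InN : ∀ {c x y e h u t} → 2 ≤ y → PShape (suc x) (suc y) → RowCut c x y e h u t →
  2 ≤ h → InN (bar h y t)
fat-piece-InN {x = x} {y} {e} {h} 2≤y shape r 2≤h =
  InN-intro (kept-nonempty r) (≤-trans (s≤s z≤n) 2≤y) ¬shape (¬NarrowStrip-fat 2≤h 2≤y)
  where
    x≤h+h : x ≤ h + h
    x≤h+h = subst (_≤ h + h) (split r) (+-monoˡ-≤ h (eaten≤kept 2≤y r))
    ¬shape : ¬ PShape (suc h) (suc y)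
    ¬shape shape′ = PShape-gap shape shape′
      (s≤s (subst (h <_) (split r) (m<n+m h (eaten-nonempty r))))
      (subst (suc x <_) (cong suc (sym (+-suc h h))) (s≤s (s≤s x≤h+h)))

single-row-colour : ∀ {c x y u t} → Odd y → RowCut c x y 1 1 u t → t ≡ c
single-row-colour {c} {y = y} {u} {t} odd r =
  odd-area⇒top-left-majority c {1} {y} t (subst Odd (sym (*-identityˡ y)) odd)
    (subst (λ v → count c 1 y v ≤ count c 1 y t) u≡not-t (allowed r))
  where
    u≡not-t : u ≡ not t
    u≡not-t with adjacent r
    ... | inj₁ u≡not-t = u≡not-t
    ... | inj₂ t≡not-u = trans (sym (not-involutive u)) (cong not (sym t≡not-u))

single-row-outcome : ∀ {c x y u t} → Odd y → RowCut c x y 1 1 u t →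
  Strips c (bar 1 y t) ⊎ InN (bar 1 y t)
single-row-outcome odd r with single-row-colour odd r
... | refl = odd-strip-outcome _ odd

m+n≡2⇒m≡1×n≡1 : ∀ {m n} → 1 ≤ m → 1 ≤ n → m + n ≡ 2 → m ≡ 1 × n ≡ 1
m+n≡2⇒m≡1×n≡1 {suc zero}    {suc zero}    _ _ _  = refl , refl
m+n≡2⇒m≡1×n≡1 {suc zero}    {suc (suc n)} _ _ ()
m+n≡2⇒m≡1×n≡1 {suc (suc m)} {suc n}       _ _ eq
  with () ← trans (sym (+-suc m n)) (suc-injective (suc-injective eq))

rowCut-outcome : ∀ {c x y e h s u t} → InP (bar x y s) → RowCut c x y e h u t →
  Strips c (bar h y t) ⊎ InN (bar h y t)
rowCut-outcome P r with InP-rows P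
... | inj₂ (refl , refl) with m+n≡2⇒m≡1×n≡1 (eaten-nonempty r) (kept-nonempty r) (split r)
...   | refl , refl = single-row-outcome 1-odd r
rowCut-outcome P r | inj₁ 2≤y with m≤n⇒m<n∨m≡n (kept-nonempty r)
... | inj₁ 2≤h = inj₂ (fat-piece-InN 2≤y (InP⇒PShape P) r 2≤h)
... | inj₂ refl with ≤-antisym (eaten≤kept 2≤y r) (eaten-nonempty r)
...   | refl with split r
...     | refl = single-row-outcome (PShape-3⇒Odd (InP⇒PShape P) (≤-trans (s≤s z≤n) 2≤y)) r

data Cut (c : Bool) : Pos → Pos → Set where
  rows    : ∀ {x y e h s u t} → RowCut c x y e h u t → Cut c (bar x y s) (bar h y t)
  columns : ∀ {x y e h s u t} → RowCut c y x e h u t → Cut c (bar x y s) (bar x h t)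

cut-outcome : ∀ {c p q} → InP p → Cut c p q → Strips c q ⊎ InN q
cut-outcome P (rows r) = rowCut-outcome P r
cut-outcome {c} P (columns r) with rowCut-outcome (InP-transpose P) r
... | inj₁ strip = inj₁ (Strips-transpose c strip)
... | inj₂ n     = inj₂ (InN-transpose n)

keep-lower : ∀ {c x y s k} → 1 ≤ k → k < x → count c k y s ≤ count c (x ∸ k) y (flip k s) →
  RowCut c x y k (x ∸ k) s (flip k s)
keep-lower 1≤k k<x le = record
  { eaten-nonempty = 1≤k
  ; kept-nonempty  = m<n⇒0<n∸m k<x
  ; split          = m+[n∸m]≡n (<⇒≤ k<x)
  ; adjacent       = inj₂ refl
  ; allowed        = le
  }

keep-upper : ∀ {c x y s k} → 1 ≤ k → k < x → count c (x ∸ k) y (flip k s) ≤ count c k y s →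
  RowCut c x y (x ∸ k) k (flip k s) s
keep-upper 1≤k k<x le = record
  { eaten-nonempty = m<n⇒0<n∸m k<x
  ; kept-nonempty  = 1≤k
  ; split          = m∸n+n≡m (<⇒≤ k<x)
  ; adjacent       = inj₁ refl
  ; allowed        = le
  }

keep-right : ∀ {c x y s k} → 1 ≤ k → k < y → count c x k s ≤ count c x (y ∸ k) (flip k s) →
  RowCut c y x k (y ∸ k) s (flip k s)
keep-right {c} {x} {y} {s} {k} 1≤k k<y le = keep-lower 1≤k k<y
  (subst₂ _≤_ (count-transpose c x k s) (count-transpose c x (y ∸ k) (flip k s)) le)

keep-left : ∀ {c x y s k} → 1 ≤ k → k < y → count c x (y ∸ k) (flip k s) ≤ count c x k s →
  RowCut c y x (y ∸ k) k (flip k s) s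
keep-left {c} {x} {y} {s} {k} 1≤k k<y le = keep-upper 1≤k k<y
  (subst₂ _≤_ (count-transpose c x (y ∸ k) (flip k s)) (count-transpose c x k s) le)

leftMove⇒Cut : ∀ {p q} → InP p → LeftMove p q → Cut true p q
leftMove⇒Cut P eatWhite                 = ⊥-elim (single-block-∉P P)
leftMove⇒Cut _ (hKeepBottom 1≤k k<x le) = rows (keep-lower 1≤k k<x le)
leftMove⇒Cut _ (hKeepTop 1≤k k<x le)    = rows (keep-upper 1≤k k<x le)
leftMove⇒Cut _ (vKeepRight 1≤k k<y le)  = columns (keep-right 1≤k k<y le)
leftMove⇒Cut _ (vKeepLeft 1≤k k<y le)   = columns (keep-left 1≤k k<y le)

rightMove⇒Cut : ∀ {p q} → InP p → RightMove p q → Cut false p q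
rightMove⇒Cut P eatBlack                 = ⊥-elim (single-block-∉P P)
rightMove⇒Cut _ (hKeepBottom 1≤k k<x le) = rows (keep-lower 1≤k k<x le)
rightMove⇒Cut _ (hKeepTop 1≤k k<x le)    = rows (keep-upper 1≤k k<x le)
rightMove⇒Cut _ (vKeepRight 1≤k k<y le)  = columns (keep-right 1≤k k<y le)
rightMove⇒Cut _ (vKeepLeft 1≤k k<y le)   = columns (keep-left 1≤k k<y le)

lemma4p15 : ((p q : Pos) → InP p → LeftMove p q → InR q ⊎ InN q)
    × ((p q : Pos) → InP p → RightMove p q → InL q ⊎ InN q)
lemma4p15 = (λ _ _ P move → cut-outcome P (leftMove⇒Cut P move))
          , (λ _ _ P move → cut-outcome P (rightMove⇒Cut P move))
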